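{- If $G$ is a graph of maximum degree $\Delta$, then $\mathrm{bcw}_1(G)\le 2(\Delta+1)^2\,\mathrm{bfw}_3(G)$.
   Context: All graphs are finite, simple and undirected. For radius-$1$ blind cop-width: a blind strategy is a sequence $C_1,\dots,C_m\subseteq V(G)$ using $\max_i|C_i|$ cops, with $A_1=V(G)\setminus C_1$ and $A_{i+1}$ the set of $u\in V(G)\setminus C_{i+1}$ reachable from some vertex of $A_i$ by a path of length at most $1$ (length $0$ allowed) in $G\setminus(C_i\cap C_{i+1})$; it is winning if $A_m=\emptyset$; $\mathrm{bcw}_1(G)$ is the minimum number of cops of a winning strategy. A $k$-flip of $G$ is a pair $(\mathcal P,F)$ with $\mathcal P$ a partition of $V(G)$ into at most $k$ parts and $F$ a graph (loops allowed) on vertex set $\mathcal P$; flipping $G$ by $(\mathcal P,F)$ yields the graph on $V(G)$ where distinct $u\in P$, $v\in Q$ ($P,Q\in\mathcal P$) are adjacent iff exactly one of $\{u,v\}\in E(G)$ and $\{P,Q\}\in E(F)$ holds. In the blind radius-$r$ flipper game the flipper fixes a sequence of $k$-flips $f_1,\dots,f_m$; $G_0=G$ and $G_i$ is $G$ flipped by $f_i$. $R_0$ is the set of non-isolated vertices of $G_0$, and for $i\ge1$, $R_i$ is the set of vertices non-isolated in $G_i$ that are reachable by a path of length at most $r$ in $G_{i-1}$ from a vertex of $R_{i-1}$. The flipper wins if $R_m=\emptyset$. $\mathrm{bfw}_r(G)$ is the minimum $k$ for which the flipper has a winning sequence of $k$-flips. -}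

module Defs where

open import Data.Nat using (ℕ; zero; suc; _+_; _≤_)
open import Data.Fin using (Fin; _≟_)
open import Data.Bool using (Bool; true; false; not; _∧_; _∨_; _xor_; if_then_else_)
open import Data.List using (List; []; _∷_; map; allFin)
open import Data.Nat.ListAction using (sum)
open import Data.Bool.ListAction using (any)
open import Data.List.Relation.Unary.All using (All)
open import Data.Product using (Σ; ∃; _×_)
open import Data.Sum using (_⊎_)
open import Relation.Nullary.Decidable using (⌊_⌋)
open import Relation.Binary.PropositionalEquality using (_≡_)

VSet : ℕ → Set
VSet n = Fin n → Bool

size : ∀ {n} → VSet n → ℕ
size {n} S = sum (map (λ v → if S v then 1 else 0) (allFin n))

anyV : ∀ {n} → (Fin n → Bool) → Bool
anyV {n} f = any f (allFin n)

_==_ : ∀ {n} → Fin n → Fin n → Bool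
u == v = ⌊ u ≟ v ⌋

record Graph (n : ℕ) : Set where
  field
    adj    : Fin n → Fin n → Bool
    sym    : ∀ u v → adj u v ≡ adj v u
    irrefl : ∀ v → adj v v ≡ false
open Graph public

deg : ∀ {n} → Graph n → Fin n → ℕ
deg G v = size (adj G v)

-- Δ is the maximum degree of G (0 for the empty graph).
MaxDegree : ∀ {n} → Graph n → ℕ → Set
MaxDegree {n} G Δ = (∀ v → deg G v ≤ Δ) × ((Δ ≡ 0) ⊎ ∃ λ v → deg G v ≡ Δ)

-- A_{i+1} from A_i, C_i, C_{i+1}: u ∉ C_{i+1}, reachable by a path of
-- length ≤ 1 from some v ∈ A_i in G ∖ (C_i ∩ C_{i+1}).
copStep : ∀ {n} → Graph n → VSet n → VSet n → VSet n → VSet n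
copStep G C C' A u =
  not (C' u) ∧ not (C u ∧ C' u) ∧
  anyV (λ v → A v ∧ not (C v ∧ C' v) ∧ ((u == v) ∨ adj G v u))

copRun : ∀ {n} → Graph n → VSet n → VSet n → List (VSet n) → VSet n
copRun G C A []         = A
copRun G C A (C' ∷ Cs)  = copRun G C' (copStep G C C' A) Cs

copFinal : ∀ {n} → Graph n → VSet n → List (VSet n) → VSet n
copFinal G C₁ Cs = copRun G C₁ (λ u → not (C₁ u)) Cs

-- c cops have a winning radius-1 blind strategy (i.e. bcw₁(G) ≤ c)
BlindCopWin : ∀ {n} → Graph n → ℕ → Set
BlindCopWin {n} G c =
  Σ (VSet n) λ C₁ → Σ (List (VSet n)) λ Cs →
    All (λ C → size C ≤ c) (C₁ ∷ Cs) × (∀ u → copFinal G C₁ Cs u ≡ false)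

-- A k-flip: a partition into at most k parts (given by labels in Fin k,
-- unused labels being empty parts) and a graph with loops on the parts.
record Flip (n k : ℕ) : Set where
  field
    part : Fin n → Fin k
    F    : Fin k → Fin k → Bool
    Fsym : ∀ P Q → F P Q ≡ F Q P
open Flip public

flipAdj : ∀ {n k} → Graph n → Flip n k → Fin n → Fin n → Bool
flipAdj G f u v = not (u == v) ∧ (adj G u v xor F f (part f u) (part f v))

reach : ∀ {n} → (Fin n → Fin n → Bool) → ℕ → VSet n → VSet n
reach a zero    S u = S u
reach a (suc r) S u = reach a r S u ∨ anyV (λ v → reach a r S v ∧ a v u)

nonIsolated : ∀ {n} → (Fin n → Fin n → Bool) → VSet n
nonIsolated a v = anyV (a v)

flipRun : ∀ {n k} → Graph n → ℕ → (Fin n → Fin n → Bool) → VSet n → List (Flip n k) → VSet n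
flipRun G r a R []       = R
flipRun G r a R (f ∷ fs) =
  flipRun G r (flipAdj G f) (λ v → nonIsolated (flipAdj G f) v ∧ reach a r R v) fs

flipFinal : ∀ {n k} → Graph n → ℕ → List (Flip n k) → VSet n
flipFinal G r fs = flipRun G r (adj G) (nonIsolated (adj G)) fs

-- the flipper wins the blind radius-r game with a (nonempty) sequence of
-- k-flips (i.e. bfw_r(G) ≤ k)
BlindFlipperWin : ∀ {n} → Graph n → ℕ → ℕ → Set
BlindFlipperWin {n} G r k =
  Σ (Flip n k) λ f₁ → Σ (List (Flip n k)) λ fs →
    ∀ v → flipFinal G r (f₁ ∷ fs) v ≡ false

-- Let f₁, …, f_m be a winning sequence of k-flips for the flipper, and call a part of a flip
-- large if it has more than 2(Δ+1) vertices. Between f_{i-1} and f_i the cops occupy the small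
-- parts of both flips and the vertices that f_i isolates although G does not: at most 4k(Δ+1) ≤
-- 2(Δ+1)²k vertices when Δ ≥ 1, because the vertices of a large part that f_i isolates are all
-- neighbours of a single vertex. A robber escaping these cops along an edge vu of G between
-- large parts of f_{i-1} moves at distance ≤ 3 in the flipped graph: if the flip removed vu, one
-- finds y in the part of u and x in the part of v outside the relevant closed neighbourhoods,
-- and v y x u is a path. Hence the robber's non-isolated positions stay inside the flipper's
-- sets R_i, which end empty; the robber is then confined to isolated vertices of G, where one
-- cop visiting every vertex in turn catches it. When Δ = 0 this sweep alone suffices.

module Submission where

open import Defs hiding (sym)
open import Data.Nat using (ℕ; zero; suc; _+_; _*_; _^_; _≤_; _<_; _≤?_; z≤n; s≤s)
open import Data.Nat.Properties
  using (≤-refl; ≤-trans; ≤-reflexive; <⇒≱; ≰⇒>; ≤-<-trans; +-mono-≤; *-monoʳ-≤;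
         m≤m+n; m≤n+m; n≤1+n; +-commutativeSemigroup; module ≤-Reasoning)
open import Algebra.Properties.CommutativeSemigroup +-commutativeSemigroup using (interchange)
open import Data.Nat.Tactic.RingSolver using (solve-∀)
open import Data.Nat.ListAction using (sum)
open import Data.Bool using (Bool; true; false; not; _∧_; _∨_; if_then_else_)
open import Data.Bool.Properties
  using (∧-conicalˡ; ∧-conicalʳ; ∨-conicalˡ; ∨-conicalʳ; not-injective; not-¬)
open import Data.Bool.ListAction using (any)
open import Data.Fin using (Fin; _≟_) renaming (zero to fzero; suc to fsuc)
open import Data.Fin.Properties using (0≢1+n; suc-injective)
open import Data.List using (List; []; _∷_; _++_; map; allFin; length)
open import Data.List.Properties using (map-tabulate; length-tabulate)
open import Data.List.Membership.Propositional using (_∈_)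
open import Data.List.Membership.Propositional.Properties using (∈-allFin)
open import Data.List.Relation.Unary.Any using (here; there)
open import Data.List.Relation.Unary.All using (All; []; _∷_)
open import Data.List.Relation.Unary.All.Properties using (++⁺)
open import Data.Product using (∃; _×_; _,_; proj₁; proj₂)
open import Data.Sum using (_⊎_; inj₁; inj₂)
open import Data.Empty using (⊥-elim)
open import Function using (_∘_)
open import Relation.Nullary using (yes; no)
open import Relation.Nullary.Decidable using (⌊_⌋)
open import Relation.Binary.PropositionalEquality
  using (_≡_; _≢_; refl; sym; trans; cong; cong₂; subst; module ≡-Reasoning)

∨-true⇒ : ∀ {a b} → a ∨ b ≡ true → a ≡ true ⊎ b ≡ true
∨-true⇒ {true}  _ = inj₁ refl
∨-true⇒ {false} p = inj₂ p

∨-trueˡ : ∀ {a b} → a ≡ true → a ∨ b ≡ true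
∨-trueˡ refl = refl

∨-trueʳ : ∀ {a b} → b ≡ true → a ∨ b ≡ true
∨-trueʳ {true}  _ = refl
∨-trueʳ {false} p = p

∧-true : ∀ {a b} → a ≡ true → b ≡ true → a ∧ b ≡ true
∧-true refl refl = refl

==⇒≡ : ∀ {n} {u v : Fin n} → u == v ≡ true → u ≡ v
==⇒≡ {u = u} {v} p with u ≟ v
... | yes u≡v = u≡v

==-refl : ∀ {n} (u : Fin n) → u == u ≡ true
==-refl u with u ≟ u
... | yes _   = refl
... | no u≢u = ⊥-elim (u≢u refl)

≢⇒==-false : ∀ {n} {u v : Fin n} → u ≢ v → u == v ≡ false
≢⇒==-false {u = u} {v} u≢v with u ≟ v
... | yes u≡v = ⊥-elim (u≢v u≡v)
... | no _    = refl

==-sym : ∀ {n} (u v : Fin n) → u == v ≡ v == u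
==-sym u v with u ≟ v | v ≟ u
... | yes _   | yes _   = refl
... | no _    | no _    = refl
... | yes u≡v | no v≢u = ⊥-elim (v≢u (sym u≡v))
... | no u≢v  | yes v≡u = ⊥-elim (u≢v (sym v≡u))

any⁺ : ∀ {A : Set} (f : A → Bool) {xs x} → x ∈ xs → f x ≡ true → any f xs ≡ true
any⁺ f (here refl) fx = ∨-trueˡ fx
any⁺ f (there x∈xs) fx = ∨-trueʳ (any⁺ f x∈xs fx)

any⁻ : ∀ {A : Set} (f : A → Bool) xs → any f xs ≡ true → ∃ λ x → f x ≡ true
any⁻ f (x ∷ xs) p with ∨-true⇒ {f x} p
... | inj₁ fx = x , fx
... | inj₂ q  = any⁻ f xs q

anyV⁺ : ∀ {n} (f : Fin n → Bool) x → f x ≡ true → anyV f ≡ true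
anyV⁺ f x = any⁺ f (∈-allFin x)

anyV⁻ : ∀ {n} (f : Fin n → Bool) → anyV f ≡ true → ∃ λ x → f x ≡ true
anyV⁻ {n} f = any⁻ f (allFin n)

anyV-false⇒ : ∀ {n} (f : Fin n → Bool) → anyV f ≡ false → ∀ x → f x ≡ false
anyV-false⇒ f none x with f x in fx
... | false = refl
... | true  = ⊥-elim (not-¬ (anyV⁺ f x fx) none)

module _ {n : ℕ} where

  ∅ : VSet n
  ∅ _ = false

  singleton : Fin n → VSet n
  singleton w x = w == x

  _∪_ : VSet n → VSet n → VSet n
  (A ∪ B) v = A v ∨ B v

  _∩_ : VSet n → VSet n → VSet n
  (A ∩ B) v = A v ∧ B v

  _⊆_ : VSet n → VSet n → Set
  A ⊆ B = ∀ v → A v ≡ true → B v ≡ true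

indicator : Bool → ℕ
indicator b = if b then 1 else 0

sum-map-mono : ∀ {A : Set} (f g : A → ℕ) → (∀ x → f x ≤ g x) →
               ∀ xs → sum (map f xs) ≤ sum (map g xs)
sum-map-mono f g f≤g []       = z≤n
sum-map-mono f g f≤g (x ∷ xs) = +-mono-≤ (f≤g x) (sum-map-mono f g f≤g xs)

sum-map-subadditive : ∀ {A : Set} (f g h : A → ℕ) → (∀ x → f x ≤ g x + h x) →
                      ∀ xs → sum (map f xs) ≤ sum (map g xs) + sum (map h xs)
sum-map-subadditive f g h f≤g+h []       = z≤n
sum-map-subadditive f g h f≤g+h (x ∷ xs) =
  ≤-trans (+-mono-≤ (f≤g+h x) (sum-map-subadditive f g h f≤g+h xs))
          (≤-reflexive (interchange (g x) (h x) (sum (map g xs)) (sum (map h xs))))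

size-mono : ∀ {n} {A B : VSet n} → A ⊆ B → size A ≤ size B
size-mono {n} {A} {B} A⊆B = sum-map-mono _ _ pointwise (allFin n)
  where
  pointwise : ∀ v → indicator (A v) ≤ indicator (B v)
  pointwise v with A v in Av
  ... | false = z≤n
  ... | true  rewrite A⊆B v Av = ≤-refl

size-∪ : ∀ {n} (A B : VSet n) → size (A ∪ B) ≤ size A + size B
size-∪ {n} A B = sum-map-subadditive _ _ _ pointwise (allFin n)
  where
  pointwise : ∀ v → indicator (A v ∨ B v) ≤ indicator (A v) + indicator (B v)
  pointwise v with A v | B v
  ... | true  | _     = s≤s z≤n
  ... | false | true  = ≤-refl
  ... | false | false = z≤n

size-suc : ∀ {n} (S : VSet (suc n)) → size S ≡ indicator (S fzero) + size (S ∘ fsuc)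
size-suc {n} S = cong (λ xs → indicator (S fzero) + sum xs)
  (trans (map-tabulate fsuc (indicator ∘ S)) (sym (map-tabulate (λ v → v) (indicator ∘ S ∘ fsuc))))

size-∅ : ∀ {n} → size (∅ {n}) ≡ 0
size-∅ {zero}  = refl
size-∅ {suc n} = trans (size-suc (∅ {suc n})) (size-∅ {n})

size-⊆∅ : ∀ {n} (A : VSet n) → A ⊆ ∅ → size A ≤ 0
size-⊆∅ {n} A A⊆∅ = ≤-trans (size-mono A⊆∅) (≤-reflexive (size-∅ {n}))

size-pos : ∀ {n} (S : VSet n) x → S x ≡ true → 0 < size S
size-pos {suc n} S fzero Sx rewrite size-suc S | Sx = s≤s z≤n
size-pos {suc n} S (fsuc x) Sx rewrite size-suc S =
  ≤-trans (size-pos (S ∘ fsuc) x Sx) (m≤n+m _ _)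

size-subsingleton : ∀ {n} (S : VSet n) → (∀ x y → S x ≡ true → S y ≡ true → x ≡ y) → size S ≤ 1
size-subsingleton {zero}  S unique = z≤n
size-subsingleton {suc n} S unique rewrite size-suc S with S fzero in S0
... | false = size-subsingleton (S ∘ fsuc) (λ x y Sx Sy → suc-injective (unique _ _ Sx Sy))
... | true  = s≤s (size-⊆∅ (S ∘ fsuc) (λ x Sx → ⊥-elim (0≢1+n (unique _ _ S0 Sx))))

size-singleton : ∀ {n} (w : Fin n) → size (singleton w) ≤ 1
size-singleton w = size-subsingleton (singleton w) (λ x y p q → trans (sym (==⇒≡ p)) (==⇒≡ q))

pigeonhole : ∀ {n} (A B : VSet n) → size B < size A → ∃ λ x → A x ≡ true × B x ≡ false
pigeonhole A B B<A with anyV (λ x → A x ∧ not (B x)) in e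
... | true  with anyV⁻ _ e
...   | x , q = x , ∧-conicalˡ _ _ q , not-injective (∧-conicalʳ _ _ q)
pigeonhole A B B<A | false = ⊥-elim (<⇒≱ B<A (size-mono A⊆B))
  where
  A⊆B : A ⊆ B
  A⊆B v Av with B v in Bv
  ... | true  = refl
  ... | false = ⊥-elim (not-¬ (∧-true Av (cong not Bv)) (anyV-false⇒ _ e v))

fibre : ∀ {n k} → (Fin n → Fin k) → Fin k → VSet n
fibre ℓ p v = ℓ v == p

size-by-fibres : ∀ {n k} (ℓ : Fin n → Fin k) (X : VSet n) (b : ℕ) →
                 (∀ p → size (X ∩ fibre ℓ p) ≤ b) → size X ≤ k * b
size-by-fibres {n} {k} ℓ X b fibre≤b =
  ≤-trans (size-mono (λ v Xv → ∧-true Xv (anyV⁺ (λ p → fibre ℓ p v) (ℓ v) (==-refl (ℓ v)))))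
          (≤-trans (over (allFin k)) (≤-reflexive (cong (_* b) (length-tabulate {n = k} _))))
  where
  over : ∀ ps → size (λ v → X v ∧ any (λ p → ℓ v == p) ps) ≤ length ps * b
  over []       = size-⊆∅ _ (λ v p → ∧-conicalʳ (X v) false p)
  over (p ∷ ps) = ≤-trans (size-mono split)
                          (≤-trans (size-∪ (X ∩ fibre ℓ p) _) (+-mono-≤ (fibre≤b p) (over ps)))
    where
    split : (λ v → X v ∧ ((ℓ v == p) ∨ any (λ p → ℓ v == p) ps)) ⊆
            ((X ∩ fibre ℓ p) ∪ (λ v → X v ∧ any (λ p → ℓ v == p) ps))
    split v q with X v | ℓ v == p
    ... | true | true  = refl
    ... | true | false = q

module _ {n : ℕ} (a : Fin n → Fin n → Bool) where

  reach-base : ∀ r S → S ⊆ reach a r S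
  reach-base zero    S v Sv = Sv
  reach-base (suc r) S v Sv = ∨-trueˡ (reach-base r S v Sv)

  reach-suc : ∀ r S → reach a r S ⊆ reach a (suc r) S
  reach-suc r S v = ∨-trueˡ

  reach-step : ∀ r S {v u} → reach a r S v ≡ true → a v u ≡ true → reach a (suc r) S u ≡ true
  reach-step r S {v} {u} v∈ vu = ∨-trueʳ {reach a r S u} (anyV⁺ _ v (∧-true v∈ vu))

  reach-path₃ : ∀ S {v y x u} → S v ≡ true → a v y ≡ true → a y x ≡ true → a x u ≡ true →
                reach a 3 S u ≡ true
  reach-path₃ S Sv vy yx xu =
    reach-step 2 S (reach-step 1 S (reach-step 0 S Sv vy) yx) xu

module _ {n k : ℕ} (G : Graph n) (f : Flip n k) where

  flipAdj-sym : ∀ u v → flipAdj G f u v ≡ flipAdj G f v u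
  flipAdj-sym u v rewrite ==-sym u v | Graph.sym G u v | Fsym f (part f u) (part f v) = refl

  flipAdj-intro : ∀ {u v} → u ≢ v → adj G u v ≡ false → F f (part f u) (part f v) ≡ true →
                  flipAdj G f u v ≡ true
  flipAdj-intro u≢v uv Fuv rewrite ≢⇒==-false u≢v | uv | Fuv = refl

  flipAdj-false⇒adj≡F : ∀ {u v} → flipAdj G f u v ≡ false → u ≢ v →
                         adj G u v ≡ F f (part f u) (part f v)
  flipAdj-false⇒adj≡F {u} {v} none u≢v rewrite ≢⇒==-false u≢v
    with adj G u v | F f (part f u) (part f v)
  ... | true  | true  = refl
  ... | false | false = refl

-- Catching a robber confined to isolated vertices

module _ {n : ℕ} (G : Graph n) where

  AllIsolated : VSet n → Set
  AllIsolated A = ∀ u → A u ≡ true → ∀ v → adj G u v ≡ false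

  copStep-isolated-⊆ : ∀ C C' A → AllIsolated A → copStep G C C' A ⊆ A
  copStep-isolated-⊆ C C' A isoA u p
    with anyV⁻ (λ v → A v ∧ not (C v ∧ C' v) ∧ ((u == v) ∨ adj G v u))
               (∧-conicalʳ _ _ (∧-conicalʳ (not (C' u)) _ p))
  ... | v , q with ∨-true⇒ {u == v} (∧-conicalʳ _ _ (∧-conicalʳ (A v) _ q))
  ...   | inj₁ u=v rewrite ==⇒≡ u=v = ∧-conicalˡ _ _ q
  ...   | inj₂ vu  = ⊥-elim (not-¬ vu (isoA v (∧-conicalˡ _ _ q) u))

  lastCops : VSet n → List (VSet n) → VSet n
  lastCops C []       = C
  lastCops C (C' ∷ Cs) = lastCops C' Cs

  copRun-++ : ∀ C A Cs Ds → copRun G C A (Cs ++ Ds) ≡ copRun G (lastCops C Cs) (copRun G C A Cs) Ds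
  copRun-++ C A []        Ds = refl
  copRun-++ C A (C' ∷ Cs) Ds = copRun-++ C' (copStep G C C' A) Cs Ds

  copStep-AllIsolated : ∀ C C' A → AllIsolated A → AllIsolated (copStep G C C' A)
  copStep-AllIsolated C C' A isoA u p = isoA u (copStep-isolated-⊆ C C' A isoA u p)

  copRun-isolated-⊆ : ∀ Cs C A → AllIsolated A → copRun G C A Cs ⊆ A
  copRun-isolated-⊆ []        C A isoA v p = p
  copRun-isolated-⊆ (C' ∷ Cs) C A isoA v p =
    copStep-isolated-⊆ C C' A isoA v
      (copRun-isolated-⊆ Cs C' _ (copStep-AllIsolated C C' A isoA) v p)

  copStep-singleton : ∀ C A w → copStep G C (singleton w) A w ≡ false
  copStep-singleton C A w rewrite ==-refl w = refl

  sweep-avoids : ∀ ws C A → AllIsolated A →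
                 ∀ u → copRun G C A (map singleton ws) u ≡ true → ∀ {w} → w ∈ ws → u ≢ w
  sweep-avoids (w ∷ ws) C A isoA u p (here refl) refl =
    not-¬ (copRun-isolated-⊆ (map singleton ws) _ _ (copStep-AllIsolated C (singleton u) A isoA) u p)
          (copStep-singleton C A u)
  sweep-avoids (w ∷ ws) C A isoA u p (there w∈ws) =
    sweep-avoids ws _ _ (copStep-AllIsolated C (singleton w) A isoA) u p w∈ws

  sweep-wins : ∀ C A → AllIsolated A → ∀ u → copRun G C A (map singleton (allFin n)) u ≡ false
  sweep-wins C A isoA u with copRun G C A (map singleton (allFin n)) u in p
  ... | false = refl
  ... | true  = ⊥-elim (sweep-avoids (allFin n) C A isoA u p (∈-allFin u) refl)

  isolatedTerritory⇒BlindCopWin : ∀ {c} → (Fin n → 1 ≤ c) → (C₁ : VSet n) (Cs : List (VSet n)) →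
    All (λ C → size C ≤ c) (C₁ ∷ Cs) → AllIsolated (copFinal G C₁ Cs) → BlindCopWin G c
  isolatedTerritory⇒BlindCopWin {c} oneCop C₁ Cs (C₁≤c ∷ Cs≤c) isolated =
    C₁ , Cs ++ map singleton (allFin n) ,
    C₁≤c ∷ ++⁺ Cs≤c (singletons (allFin n)) ,
    λ u → trans (cong (λ A → A u) (copRun-++ C₁ _ Cs _)) (sweep-wins _ _ isolated u)
    where
    singletons : ∀ ws → All (λ C → size C ≤ c) (map singleton ws)
    singletons []       = []
    singletons (w ∷ ws) = ≤-trans (size-singleton w) (oneCop w) ∷ singletons ws

-- Cops shadowing a flipper strategy

cop-budget : ∀ a k → 2 ≤ a → k * (a + a) + k * (a + a) ≤ 2 * a ^ 2 * k
cop-budget a k 2≤a = begin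
  k * (a + a) + k * (a + a) ≡⟨ double a k ⟩
  2 * a * k * 2             ≤⟨ *-monoʳ-≤ (2 * a * k) 2≤a ⟩
  2 * a * k * a             ≡⟨ reorder a k ⟩
  2 * a ^ 2 * k             ∎
  where
  open ≤-Reasoning
  double : ∀ a k → k * (a + a) + k * (a + a) ≡ 2 * a * k * 2
  double = solve-∀
  reorder : ∀ a k → 2 * a * k * a ≡ 2 * (a * (a * 1)) * k
  reorder = solve-∀

module Shadowing {n : ℕ} (G : Graph n) (Δ : ℕ) (deg≤Δ : ∀ v → deg G v ≤ Δ) where

  threshold : ℕ
  threshold = suc Δ + suc Δ

  N[_] : Fin n → VSet n
  N[ v ] = singleton v ∪ adj G v

  size-N : ∀ v → size N[ v ] ≤ suc Δ
  size-N v = ≤-trans (size-∪ (singleton v) (adj G v)) (+-mono-≤ (size-singleton v) (deg≤Δ v))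

  size-N≤threshold : ∀ v → size N[ v ] ≤ threshold
  size-N≤threshold v = ≤-trans (size-N v) (m≤m+n (suc Δ) (suc Δ))

  adj⇒≢ : ∀ {u v} → adj G u v ≡ true → u ≢ v
  adj⇒≢ {u} uv refl = not-¬ uv (irrefl G u)

  outside-N : ∀ {v x} → N[ v ] x ≡ false → v ≢ x × adj G v x ≡ false
  outside-N {v} {x} vx = (λ v≡x → not-¬ (≡⇒== v≡x) (∨-conicalˡ _ _ vx)) , ∨-conicalʳ (v == x) _ vx
    where
    ≡⇒== : v ≡ x → v == x ≡ true
    ≡⇒== refl = ==-refl v

  module _ {k : ℕ} (f : Flip n k) where

    flipped : Fin n → Fin n → Bool
    flipped = flipAdj G f

    partOf : Fin k → VSet n
    partOf = fibre (part f)

    Large : Fin k → Set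
    Large p = threshold < size (partOf p)

    small : VSet n
    small v = ⌊ size (partOf (part f v)) ≤? threshold ⌋

    small≡false⇒Large : ∀ {v} → small v ≡ false → Large (part f v)
    small≡false⇒Large {v} sv with size (partOf (part f v)) ≤? threshold
    ... | no ¬small = ≰⇒> ¬small

    Large⇒small≡false : ∀ {v p} → Large p → partOf p v ≡ true → small v ≡ false
    Large⇒small≡false {v} large pv with size (partOf (part f v)) ≤? threshold
    ... | yes small = ⊥-elim (<⇒≱ large (subst (λ q → size (partOf q) ≤ threshold) (==⇒≡ pv) small))
    ... | no _      = refl

    isolatedBy : VSet n
    isolatedBy v = nonIsolated (adj G) v ∧ not (nonIsolated flipped v)

    isolatedIn : Fin k → VSet n
    isolatedIn p = isolatedBy ∩ partOf p

    flipAdj-outside-N : ∀ {v x} → N[ v ] x ≡ false → F f (part f v) (part f x) ≡ true →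
                        flipped v x ≡ true
    flipAdj-outside-N vx = flipAdj-intro G f (proj₁ (outside-N vx)) (proj₂ (outside-N vx))

    Path₃ : Fin n → Fin n → Set
    Path₃ v u = ∃ λ y → ∃ λ x → flipped v y ≡ true × flipped y x ≡ true × flipped x u ≡ true

    -- A large part always has a vertex outside any two closed neighbourhoods.
    large-parts-path₃ : ∀ {u v} → F f (part f v) (part f u) ≡ true →
                        small u ≡ false → small v ≡ false → Path₃ v u
    large-parts-path₃ {u} {v} Fvu su sv
      with pigeonhole (partOf (part f u)) N[ v ]
             (≤-<-trans (size-N≤threshold v) (small≡false⇒Large su))
    ... | y , y∈Pu , vy
      with pigeonhole (partOf (part f v)) (N[ y ] ∪ N[ u ])
             (≤-<-trans (≤-trans (size-∪ N[ y ] N[ u ]) (+-mono-≤ (size-N y) (size-N u)))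
                        (small≡false⇒Large sv))
    ...   | x , x∈Pv , yx∪ux = y , x , v-y , y-x , x-u
      where
      Fuv : F f (part f u) (part f v) ≡ true
      Fuv = trans (Fsym f (part f u) (part f v)) Fvu
      v-y : flipped v y ≡ true
      v-y = flipAdj-outside-N vy (trans (cong (F f (part f v)) (==⇒≡ y∈Pu)) Fvu)
      y-x : flipped y x ≡ true
      y-x = flipAdj-outside-N (∨-conicalˡ _ _ yx∪ux)
                              (trans (cong₂ (F f) (==⇒≡ y∈Pu) (==⇒≡ x∈Pv)) Fuv)
      x-u : flipped x u ≡ true
      x-u = trans (flipAdj-sym G f x u)
                  (flipAdj-outside-N (∨-conicalʳ (N[ y ] x) _ yx∪ux)
                                     (trans (cong (F f (part f u)) (==⇒≡ x∈Pv)) Fuv))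

    adj⇒reach₃ : ∀ R {u v} → R v ≡ true → adj G v u ≡ true → small u ≡ false → small v ≡ false →
                 reach flipped 3 R u ≡ true
    adj⇒reach₃ R {u} {v} Rv vu su sv = by-flip (flipped v u) refl
      where
      by-flip : ∀ b → flipped v u ≡ b → reach flipped 3 R u ≡ true
      by-flip true kept =
        reach-suc flipped 2 R u (reach-suc flipped 1 R u (reach-step flipped 0 R Rv kept))
      by-flip false removed =
        along (large-parts-path₃ (trans (sym (flipAdj-false⇒adj≡F G f removed (adj⇒≢ vu))) vu) su sv)
        where
        along : Path₃ v u → reach flipped 3 R u ≡ true
        along (y , x , v-y , y-x , x-u) = reach-path₃ flipped R Rv v-y y-x x-u

    isolatedBy⇒adj≡F : ∀ {v x} → isolatedBy v ≡ true → v ≢ x → adj G v x ≡ F f (part f v) (part f x)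
    isolatedBy⇒adj≡F {v} {x} iso =
      flipAdj-false⇒adj≡F G f (anyV-false⇒ (flipped v) (not-injective (∧-conicalʳ _ _ iso)) x)

    isolatedBy≡false⇒ : ∀ {v} → isolatedBy v ≡ false → nonIsolated (adj G) v ≡ true →
                        nonIsolated flipped v ≡ true
    isolatedBy≡false⇒ notIso nonIso rewrite nonIso = not-injective notIso

    isolatedIn⇒isolatedBy : ∀ {p v} → isolatedIn p v ≡ true → isolatedBy v ≡ true
    isolatedIn⇒isolatedBy = ∧-conicalˡ _ _

    isolatedIn⇒part : ∀ {p v} → isolatedIn p v ≡ true → part f v ≡ p
    isolatedIn⇒part = ==⇒≡ ∘ ∧-conicalʳ _ _

    loop⇒partOf⊆N : ∀ {p v} → isolatedIn p v ≡ true → F f p p ≡ true → partOf p ⊆ N[ v ]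
    loop⇒partOf⊆N {p} {v} v∈ loop x x∈P with v ≟ x
    ... | yes refl = refl
    ... | no v≢x   = begin
      adj G v x                 ≡⟨ isolatedBy⇒adj≡F (isolatedIn⇒isolatedBy v∈) v≢x ⟩
      F f (part f v) (part f x) ≡⟨ cong₂ (F f) (isolatedIn⇒part v∈) (==⇒≡ x∈P) ⟩
      F f p p                   ≡⟨ loop ⟩
      true                      ∎
      where open ≡-Reasoning

    isolatedIn-Large⊆adj : ∀ {p v₀ u₀} → Large p → isolatedIn p v₀ ≡ true → adj G v₀ u₀ ≡ true →
                           isolatedIn p ⊆ adj G u₀
    isolatedIn-Large⊆adj {p} {v₀} {u₀} large v₀∈ v₀u₀ v v∈ with v ≟ u₀
    -- u₀ in the part forces a loop of F at p, which puts the whole part into N[ v₀ ].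
    ... | yes refl =
      ⊥-elim (<⇒≱ large (≤-trans (size-mono (loop⇒partOf⊆N v₀∈ loop)) (size-N≤threshold v₀)))
      where
      open ≡-Reasoning
      loop : F f p p ≡ true
      loop = begin
        F f p p                     ≡⟨ sym (cong₂ (F f) (isolatedIn⇒part v₀∈) (isolatedIn⇒part v∈)) ⟩
        F f (part f v₀) (part f v)  ≡⟨ sym (isolatedBy⇒adj≡F (isolatedIn⇒isolatedBy v₀∈) (adj⇒≢ v₀u₀)) ⟩
        adj G v₀ v                  ≡⟨ v₀u₀ ⟩
        true                        ∎
    ... | no v≢u₀ = begin
      adj G u₀ v                  ≡⟨ Graph.sym G u₀ v ⟩
      adj G v u₀                  ≡⟨ isolatedBy⇒adj≡F (isolatedIn⇒isolatedBy v∈) v≢u₀ ⟩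
      F f (part f v) (part f u₀)  ≡⟨ cong (λ q → F f q (part f u₀))
                                          (trans (isolatedIn⇒part v∈) (sym (isolatedIn⇒part v₀∈))) ⟩
      F f (part f v₀) (part f u₀) ≡⟨ sym (isolatedBy⇒adj≡F (isolatedIn⇒isolatedBy v₀∈) (adj⇒≢ v₀u₀)) ⟩
      adj G v₀ u₀                 ≡⟨ v₀u₀ ⟩
      true                        ∎
      where open ≡-Reasoning

    size-isolatedIn-Large : ∀ {p} → Large p → size (isolatedIn p) ≤ Δ
    size-isolatedIn-Large {p} large with anyV (isolatedIn p) in some
    ... | false =
      ≤-trans (size-⊆∅ (isolatedIn p) (λ v v∈ → ⊥-elim (not-¬ v∈ (anyV-false⇒ (isolatedIn p) some v))))
              z≤n
    ... | true with anyV⁻ (isolatedIn p) some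
    ...   | v₀ , v₀∈ with anyV⁻ (adj G v₀) (∧-conicalˡ _ _ (isolatedIn⇒isolatedBy v₀∈))
    ...     | u₀ , v₀u₀ = ≤-trans (size-mono (isolatedIn-Large⊆adj large v₀∈ v₀u₀)) (deg≤Δ u₀)

    size-small∪isolatedBy-part : ∀ p → size ((small ∪ isolatedBy) ∩ partOf p) ≤ threshold
    size-small∪isolatedBy-part p with size (partOf p) ≤? threshold
    ... | yes small-p = ≤-trans (size-mono {B = partOf p} (λ v → ∧-conicalʳ _ _)) small-p
    ... | no ¬small-p = begin
      size ((small ∪ isolatedBy) ∩ partOf p) ≤⟨ size-mono ⊆isolatedIn ⟩
      size (isolatedIn p)                    ≤⟨ size-isolatedIn-Large (≰⇒> ¬small-p) ⟩
      Δ                                      ≤⟨ n≤1+n Δ ⟩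
      suc Δ                                  ≤⟨ m≤m+n (suc Δ) (suc Δ) ⟩
      threshold                              ∎
      where
      open ≤-Reasoning
      ⊆isolatedIn : ((small ∪ isolatedBy) ∩ partOf p) ⊆ isolatedIn p
      ⊆isolatedIn v v∈ with ∨-true⇒ {small v} (∧-conicalˡ _ _ v∈)
      ... | inj₁ sv = ⊥-elim (not-¬ sv (Large⇒small≡false (≰⇒> ¬small-p) (∧-conicalʳ _ _ v∈)))
      ... | inj₂ iv = ∧-true iv (∧-conicalʳ _ _ v∈)

    size-small∪isolatedBy : size (small ∪ isolatedBy) ≤ k * threshold
    size-small∪isolatedBy = size-by-fibres (part f) _ threshold size-small∪isolatedBy-part

  cops : ∀ {k} → Flip n k → Flip n k → VSet n
  cops g f = small g ∪ (small f ∪ isolatedBy f)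

  cops-free : ∀ {k} (g f : Flip n k) {u} → cops g f u ≡ false →
              small g u ≡ false × small f u ≡ false × isolatedBy f u ≡ false
  cops-free g f {u} free =
    ∨-conicalˡ _ _ free , ∨-conicalˡ _ _ free-f , ∨-conicalʳ (small f u) _ free-f
    where
    free-f : (small f ∪ isolatedBy f) u ≡ false
    free-f = ∨-conicalʳ (small g u) _ free

  size-cops : ∀ {k} (g f : Flip n k) → 1 ≤ Δ → size (cops g f) ≤ 2 * (suc Δ ^ 2) * k
  size-cops {k} g f 1≤Δ =
    ≤-trans (size-∪ (small g) (small f ∪ isolatedBy f))
    (≤-trans (+-mono-≤ (≤-trans (size-mono {B = small g ∪ isolatedBy g} (λ v → ∨-trueˡ))
                                (size-small∪isolatedBy g))
                       (size-small∪isolatedBy f))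
             (cop-budget (suc Δ) k (s≤s 1≤Δ)))

  copsAfter : ∀ {k} → Flip n k → List (Flip n k) → List (VSet n)
  copsAfter g []       = []
  copsAfter g (f ∷ fs) = cops g f ∷ copsAfter f fs

  size-copsAfter : ∀ {k} (g : Flip n k) fs → 1 ≤ Δ →
                   All (λ C → size C ≤ 2 * (suc Δ ^ 2) * k) (copsAfter g fs)
  size-copsAfter g []       1≤Δ = []
  size-copsAfter g (f ∷ fs) 1≤Δ = size-cops g f 1≤Δ ∷ size-copsAfter f fs 1≤Δ

  InLargeParts : ∀ {k} → Flip n k → VSet n → Set
  InLargeParts g A = ∀ v → A v ≡ true → small g v ≡ false

  Shadows : VSet n → VSet n → Set
  Shadows A R = ∀ v → A v ≡ true → nonIsolated (adj G) v ≡ true → R v ≡ true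

  copStep-InLargeParts : ∀ {k} (g f : Flip n k) C A → InLargeParts f (copStep G C (cops g f) A)
  copStep-InLargeParts g f C A v step =
    proj₁ (proj₂ (cops-free g f (not-injective (∧-conicalˡ _ _ step))))

  shadows-step : ∀ {k} (g f : Flip n k) C A R → InLargeParts g A → Shadows A R →
                 Shadows (copStep G C (cops g f) A) (nonIsolated (flipAdj G f) ∩ reach (flipped g) 3 R)
  shadows-step g f C A R A-large shadows u step nonIso =
    ∧-true (isolatedBy≡false⇒ f (proj₂ (proj₂ free)) nonIso) (from (anyV⁻ _ robberMoves))
    where
    free : small g u ≡ false × small f u ≡ false × isolatedBy f u ≡ false
    free = cops-free g f (not-injective (∧-conicalˡ _ _ step))
    robberMoves : anyV (λ v → A v ∧ not (C v ∧ cops g f v) ∧ ((u == v) ∨ adj G v u)) ≡ true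
    robberMoves = ∧-conicalʳ (not (C u ∧ cops g f u)) _ (∧-conicalʳ (not (cops g f u)) _ step)
    from : (∃ λ v → (A v ∧ not (C v ∧ cops g f v) ∧ ((u == v) ∨ adj G v u)) ≡ true) →
           reach (flipped g) 3 R u ≡ true
    from (v , q) with ∨-true⇒ {u == v} (∧-conicalʳ _ _ (∧-conicalʳ (A v) _ q))
    ... | inj₁ u=v rewrite ==⇒≡ u=v = reach-base (flipped g) 3 R v (shadows v Av nonIso)
      where
      Av : A v ≡ true
      Av = ∧-conicalˡ _ _ q
    ... | inj₂ vu  = adj⇒reach₃ g R (shadows v Av (anyV⁺ (adj G v) u vu)) vu (proj₁ free) (A-large v Av)
      where
      Av : A v ≡ true
      Av = ∧-conicalˡ _ _ q

  shadows-run : ∀ {k} (g : Flip n k) fs C A R → InLargeParts g A → Shadows A R →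
                Shadows (copRun G C A (copsAfter g fs)) (flipRun G 3 (flipped g) R fs)
  shadows-run g []       C A R A-large shadows = shadows
  shadows-run g (f ∷ fs) C A R A-large shadows =
    shadows-run f fs (cops g f) _ _ (copStep-InLargeParts g f C A)
                (shadows-step g f C A R A-large shadows)

  shadowing-isolates : ∀ {k} (f₁ : Flip n k) fs → (∀ v → flipFinal G 3 (f₁ ∷ fs) v ≡ false) →
                       AllIsolated G (copFinal G (cops f₁ f₁) (copsAfter f₁ fs))
  shadowing-isolates f₁ fs flipperWins u robber v with nonIsolated (adj G) u in nonIso
  ... | false = anyV-false⇒ (adj G u) nonIso v
  ... | true  =
    ⊥-elim (not-¬ (shadows-run f₁ fs _ _ _ A₁-large shadows₁ u robber nonIso) (flipperWins u))
    where
    A₁-large : InLargeParts f₁ (λ v → not (cops f₁ f₁ v))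
    A₁-large v A₁v = proj₁ (cops-free f₁ f₁ (not-injective A₁v))
    shadows₁ : Shadows (λ v → not (cops f₁ f₁ v))
                       (nonIsolated (flipped f₁) ∩ reach (adj G) 3 (nonIsolated (adj G)))
    shadows₁ v A₁v nonIso-v =
      ∧-true (isolatedBy≡false⇒ f₁ (proj₂ (proj₂ (cops-free f₁ f₁ (not-injective A₁v)))) nonIso-v)
             (reach-base (adj G) 3 _ v nonIso-v)

edgeless-isolated : ∀ {n} (G : Graph n) → (∀ v → deg G v ≤ 0) → ∀ A → AllIsolated G A
edgeless-isolated G deg≤0 A u _ v with adj G u v in uv
... | false = refl
... | true  = ⊥-elim (<⇒≱ (size-pos (adj G u) v uv) (deg≤0 u))

cops-available : ∀ Δ {k} → Fin k → 1 ≤ 2 * (suc Δ ^ 2) * k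
cops-available Δ {suc k} _ = s≤s z≤n

proposition5p7 : ∀ {n} (G : Graph n) (Δ : ℕ) → MaxDegree G Δ →
                 (k : ℕ) → BlindFlipperWin G 3 k →
                 BlindCopWin G (2 * (suc Δ ^ 2) * k)
proposition5p7 {n} G zero (deg≤0 , _) k (f₁ , _ , _) =
  isolatedTerritory⇒BlindCopWin G (cops-available zero ∘ part f₁) ∅ []
    (≤-trans (≤-reflexive (size-∅ {n})) z≤n ∷ []) (edgeless-isolated G deg≤0 _)
proposition5p7 G Δ@(suc _) (deg≤Δ , _) k (f₁ , fs , flipperWins) =
  isolatedTerritory⇒BlindCopWin G (cops-available Δ ∘ part f₁) (cops f₁ f₁) (copsAfter f₁ fs)
    (size-copsAfter f₁ (f₁ ∷ fs) (s≤s z≤n)) (shadowing-isolates f₁ fs flipperWins)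
  where open Shadowing G Δ deg≤Δ
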